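{- For $m\ge 4$, let $J=J(2m,m)_{\{1,m-1\}}$. Then $\mathrm{Dist}(J)>2$.
   Context: $J(2m,m)_{\{1,m-1\}}$ has as vertices the $m$-subsets of $\{1,\dots,2m\}$, with $M,N$ adjacent iff $|M\cap N|\in\{m-1,1\}$. For a graph $G$, a coloring $f:V(G)\to\{1,\dots,r\}$ is $r$-distinguishing if the identity is the only automorphism $\phi$ of $G$ with $f(\phi(v))=f(v)$ for all $v$; $\mathrm{Dist}(G)$ is the minimum such $r$. -}

module Defs where

open import Data.Nat using (ℕ; _*_; _∸_)
open import Data.Fin using (Fin)
open import Data.Fin.Subset using (Subset; _∩_; ∣_∣)
open import Data.Sum using (_⊎_)
open import Data.Product using (_×_)
open import Relation.Binary.PropositionalEquality using (_≡_)
open import Relation.Nullary using (¬_)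

record Graph : Set₁ where
  field
    V   : Set
    Adj : V → V → Set
open Graph public

record Automorphism (G : Graph) : Set where
  field
    to       : V G → V G
    from     : V G → V G
    to-from  : ∀ v → to (from v) ≡ v
    from-to  : ∀ v → from (to v) ≡ v
    adj-to   : ∀ u v → Adj G u v → Adj G (to u) (to v)
    adj-from : ∀ u v → Adj G (to u) (to v) → Adj G u v
open Automorphism public

Distinguishing : (G : Graph) (r : ℕ) → (V G → Fin r) → Set
Distinguishing G r f =
  (φ : Automorphism G) → (∀ v → f (to φ v) ≡ f v) → ∀ v → to φ v ≡ v

DistGreaterThan : Graph → ℕ → Set
DistGreaterThan G k =
  (r : ℕ) → r Data.Nat.≤ k → (f : V G → Fin r) → ¬ Distinguishing G r f

-- m-subsets of {1..2m} (as Fin (2 * m)); the cardinality proof is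
-- irrelevant, so vertices are equal iff their underlying subsets are.
record MSubset (m : ℕ) : Set where
  constructor ⟨_,_⟩
  field
    set   : Subset (2 * m)
    .card : ∣ set ∣ ≡ m
open MSubset public

J : ℕ → Graph
J m = record
  { V   = MSubset m
  ; Adj = λ M N → (∣ set M ∩ set N ∣ ≡ m ∸ 1) ⊎ (∣ set M ∩ set N ∣ ≡ 1)
  }

-- Complementation N ↦ ∁ N is an automorphism, and since ∣ M ∩ ∁ N ∣ = m − ∣ M ∩ N ∣
-- and the set {1, m − 1} is closed under k ↦ m − k, adjacency only depends on the
-- complementary pairs {N, ∁ N}.  Hence any involution that sends each vertex into
-- the pair of its image under an automorphism h is again an automorphism.
-- Given a 2-colouring f, if some pair {A, ∁ A} is monochromatic, swapping A and ∁ A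
-- is a nontrivial colour-preserving automorphism.  Otherwise ∁ exchanges the two
-- colours, and composing the transposition σ = (0 1) of points with ∁ wherever σ
-- changes the colour of N gives a colour-preserving automorphism, which moves any
-- N containing 0 but not 1.
module Submission where

open import Defs
open import Data.Nat using (ℕ; _≤_; s≤s; z≤n; suc; _+_; _∸_)
open import Data.Nat.Properties
  using (+-suc; +-identityʳ; m+n∸m≡n; m∸[m∸n]≡n; m+1+n≢0) renaming (_≟_ to _≟ℕ_)
open import Data.Bool using (true; false)
open import Data.Bool.Properties using () renaming (_≟_ to _≟ᴮ_)
open import Data.Vec using ([]; _∷_; _++_)
open import Data.Vec.Properties using (≡-dec; ∷-injectiveˡ; ∷-injectiveʳ)
open import Data.Fin using (Fin; zero; suc; inject≤)
open import Data.Fin.Properties using (inject≤-injective) renaming (_≟_ to _≟ᶠ_)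
open import Data.Fin.Subset using (Subset; _∩_; ∣_∣; ∁; ⊤; ⊥)
open import Data.Fin.Subset.Properties
  using (∣∁p∣≡n∸∣p∣; ∩-comm; ∣⊤∣≡n; ∪-∩-booleanAlgebra)
import Algebra.Lattice.Properties.BooleanAlgebra as BooleanAlgebraProperties
open import Data.Sum using (_⊎_; inj₁; inj₂)
open import Function using (id)
open import Relation.Binary.Definitions using (DecidableEquality)
open import Relation.Nullary using (¬_; Dec; yes; no; contradiction)
open import Relation.Nullary.Decidable using (recompute; map′; _⊎-dec_)
open import Relation.Binary.PropositionalEquality
  using (_≡_; _≢_; refl; sym; trans; cong; subst; subst₂; module ≡-Reasoning)

∁-involutive : ∀ {n} (p : Subset n) → ∁ (∁ p) ≡ p
∁-involutive {n} = BooleanAlgebraProperties.¬-involutive (∪-∩-booleanAlgebra n)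

∁p≡p⇒n≡0 : ∀ {n} (p : Subset n) → ∁ p ≡ p → n ≡ 0
∁p≡p⇒n≡0 []          _ = refl
∁p≡p⇒n≡0 (true ∷ _)  ()
∁p≡p⇒n≡0 (false ∷ _) ()

∣p∩q∣+∣p∩∁q∣≡∣p∣ : ∀ {n} (p q : Subset n) → ∣ p ∩ q ∣ + ∣ p ∩ ∁ q ∣ ≡ ∣ p ∣
∣p∩q∣+∣p∩∁q∣≡∣p∣ []          []          = refl
∣p∩q∣+∣p∩∁q∣≡∣p∣ (true ∷ p)  (true ∷ q)  = cong suc (∣p∩q∣+∣p∩∁q∣≡∣p∣ p q)
∣p∩q∣+∣p∩∁q∣≡∣p∣ (true ∷ p)  (false ∷ q) =
  trans (+-suc _ _) (cong suc (∣p∩q∣+∣p∩∁q∣≡∣p∣ p q))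
∣p∩q∣+∣p∩∁q∣≡∣p∣ (false ∷ p) (_ ∷ q)     = ∣p∩q∣+∣p∩∁q∣≡∣p∣ p q

∣⊥++p∣≡∣p∣ : ∀ k {n} (p : Subset n) → ∣ ⊥ {n = k} ++ p ∣ ≡ ∣ p ∣
∣⊥++p∣≡∣p∣ 0       p = refl
∣⊥++p∣≡∣p∣ (suc k) p = ∣⊥++p∣≡∣p∣ k p

swap₀₁ : ∀ {n} → Subset (suc (suc n)) → Subset (suc (suc n))
swap₀₁ (x ∷ y ∷ p) = y ∷ x ∷ p

swap₀₁-involutive : ∀ {n} (p : Subset (suc (suc n))) → swap₀₁ (swap₀₁ p) ≡ p
swap₀₁-involutive (_ ∷ _ ∷ _) = refl

swap₀₁-∁ : ∀ {n} (p : Subset (suc (suc n))) → swap₀₁ (∁ p) ≡ ∁ (swap₀₁ p)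
swap₀₁-∁ (_ ∷ _ ∷ _) = refl

swap₀₁-∩ : ∀ {n} (p q : Subset (suc (suc n))) → swap₀₁ p ∩ swap₀₁ q ≡ swap₀₁ (p ∩ q)
swap₀₁-∩ (_ ∷ _ ∷ _) (_ ∷ _ ∷ _) = refl

∣swap₀₁p∣≡∣p∣ : ∀ {n} (p : Subset (suc (suc n))) → ∣ swap₀₁ p ∣ ≡ ∣ p ∣
∣swap₀₁p∣≡∣p∣ (true  ∷ true  ∷ _) = refl
∣swap₀₁p∣≡∣p∣ (true  ∷ false ∷ _) = refl
∣swap₀₁p∣≡∣p∣ (false ∷ true  ∷ _) = refl
∣swap₀₁p∣≡∣p∣ (false ∷ false ∷ _) = refl

≢-≢⇒≡ : {a b c : Fin 2} → a ≢ b → b ≢ c → a ≡ c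
≢-≢⇒≡ {zero}     {zero}             a≢b _   = contradiction refl a≢b
≢-≢⇒≡ {suc zero} {suc zero}         a≢b _   = contradiction refl a≢b
≢-≢⇒≡ {_}        {zero}     {zero}     _ b≢c = contradiction refl b≢c
≢-≢⇒≡ {_}        {suc zero} {suc zero} _ b≢c = contradiction refl b≢c
≢-≢⇒≡ {zero}     {suc zero} {zero}     _ _   = refl
≢-≢⇒≡ {suc zero} {zero}     {suc zero} _ _   = refl

involution⇒automorphism : (G : Graph) (g : V G → V G) → (∀ v → g (g v) ≡ v) →
                          (∀ u v → Adj G u v → Adj G (g u) (g v)) → Automorphism G
involution⇒automorphism G g g-involutive g-adj = record
  { to       = g
  ; from     = g
  ; to-from  = g-involutive
  ; from-to  = g-involutive
  ; adj-to   = g-adj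
  ; adj-from = λ u v a →
      subst₂ (Adj G) (g-involutive u) (g-involutive v) (g-adj (g u) (g v) a)
  }

distinguishing-∘-injective : ∀ {G r s} {f : V G → Fin r} {ι : Fin r → Fin s} →
                             (∀ {i j} → ι i ≡ ι j → i ≡ j) →
                             Distinguishing G r f → Distinguishing G s (λ v → ι (f v))
distinguishing-∘-injective ι-injective D φ ι∘f-preserved =
  D φ (λ v → ι-injective (ι∘f-preserved v))

module Involution {X : Set} (c : X → X) (c-involutive : ∀ x → c (c x) ≡ x) where

  Orbit : X → X → Set
  Orbit z y = y ≡ z ⊎ y ≡ c z

  orbit-sym : ∀ {z y} → Orbit z y → Orbit y z
  orbit-sym (inj₁ refl) = inj₁ refl
  orbit-sym {z} (inj₂ refl) = inj₂ (sym (c-involutive z))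

  orbit-c : ∀ {z y} → Orbit z y → Orbit z (c y)
  orbit-c (inj₁ refl) = inj₂ refl
  orbit-c {z} (inj₂ refl) = inj₁ (c-involutive z)

  module OrbitTransposition (_≟_ : DecidableEquality X) (A : X) where

    orbit? : ∀ x → Dec (Orbit A x)
    orbit? x = (x ≟ A) ⊎-dec (x ≟ c A)

    transpose : X → X
    transpose x with orbit? x
    ... | yes _ = c x
    ... | no  _ = x

    transpose-orbit : ∀ x → Orbit x (transpose x)
    transpose-orbit x with orbit? x
    ... | yes _ = inj₂ refl
    ... | no  _ = inj₁ refl

    transpose-A : transpose A ≡ c A
    transpose-A with orbit? A
    ... | yes _        = refl
    ... | no  A∉orbitA = contradiction (inj₁ refl) A∉orbitA

    transpose-involutive : ∀ x → transpose (transpose x) ≡ x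
    transpose-involutive x with orbit? x
    ... | no x∉orbit with orbit? x
    ...   | yes x∈orbit = contradiction x∈orbit x∉orbit
    ...   | no  _       = refl
    transpose-involutive x | yes x∈orbit with orbit? (c x)
    ...   | yes _         = c-involutive x
    ...   | no  cx∉orbit = contradiction (orbit-c x∈orbit) cx∉orbit

    transpose-preserves : {Y : Set} (f : X → Y) → f A ≡ f (c A) → ∀ x → f (transpose x) ≡ f x
    transpose-preserves f fA≡fcA x with orbit? x
    ... | no  _           = refl
    ... | yes (inj₁ refl) = sym fA≡fcA
    ... | yes (inj₂ refl) = trans (cong f (c-involutive A)) fA≡fcA

  -- Since c exchanges the two colours, correct x is the unique point of the
  -- orbit of σ x having the colour of x; this is what makes it an involution.
  module ColourCorrection (σ : X → X) (σ-involutive : ∀ x → σ (σ x) ≡ x)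
                          (σ-c : ∀ x → σ (c x) ≡ c (σ x))
                          (f : X → Fin 2) (f-c : ∀ x → f (c x) ≢ f x) where

    correct : X → X
    correct x with f (σ x) ≟ᶠ f x
    ... | yes _ = σ x
    ... | no  _ = c (σ x)

    correct-orbit : ∀ x → Orbit (σ x) (correct x)
    correct-orbit x with f (σ x) ≟ᶠ f x
    ... | yes _ = inj₁ refl
    ... | no  _ = inj₂ refl

    correct-preserves : ∀ x → f (correct x) ≡ f x
    correct-preserves x with f (σ x) ≟ᶠ f x
    ... | yes fσx≡fx = fσx≡fx
    ... | no  fσx≢fx = ≢-≢⇒≡ (f-c (σ x)) fσx≢fx

    orbit-colour-injective : ∀ {z y y′} → Orbit z y → Orbit z y′ → f y ≡ f y′ → y ≡ y′
    orbit-colour-injective     (inj₁ refl) (inj₁ refl) _ = refl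
    orbit-colour-injective {z} (inj₁ refl) (inj₂ refl) e = contradiction (sym e) (f-c z)
    orbit-colour-injective {z} (inj₂ refl) (inj₁ refl) e = contradiction e (f-c z)
    orbit-colour-injective     (inj₂ refl) (inj₂ refl) _ = refl

    σ-orbit : ∀ {z y} → Orbit z y → Orbit (σ z) (σ y)
    σ-orbit (inj₁ refl) = inj₁ refl
    σ-orbit {z} (inj₂ refl) = inj₂ (σ-c z)

    correct-involutive : ∀ x → correct (correct x) ≡ x
    correct-involutive x =
      orbit-colour-injective (correct-orbit y) x∈orbitσy
        (trans (correct-preserves y) (correct-preserves x))
      where
      y = correct x
      x∈orbitσy : Orbit (σ y) x
      x∈orbitσy = orbit-sym (subst (λ w → Orbit w (σ y)) (σ-involutive x) (σ-orbit (correct-orbit x)))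

Admissible : ℕ → ℕ → Set
Admissible m k = (k ≡ m ∸ 1) ⊎ (k ≡ 1)

admissible-∸ : ∀ {m k} → Admissible m k → Admissible m (m ∸ k)
admissible-∸ {0}     (inj₁ refl) = inj₁ refl
admissible-∸ {0}     (inj₂ refl) = inj₁ refl
admissible-∸ {suc m} (inj₁ refl) = inj₂ (m∸[m∸n]≡n {suc m} (s≤s z≤n))
admissible-∸ {suc m} (inj₂ refl) = inj₁ refl

module _ {m : ℕ} where

  MSubset-≡ : {M N : MSubset m} → set M ≡ set N → M ≡ N
  MSubset-≡ refl = refl

  _≟ᴹ_ : DecidableEquality (MSubset m)
  M ≟ᴹ N = map′ MSubset-≡ (cong set) (≡-dec _≟ᴮ_ (set M) (set N))

  cardinality : (M : MSubset m) → ∣ set M ∣ ≡ m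
  cardinality ⟨ s , ∣s∣≡m ⟩ = recompute (∣ s ∣ ≟ℕ m) ∣s∣≡m

  ∁ᴹ : MSubset m → MSubset m
  ∁ᴹ M = ⟨ ∁ (set M) , ∣∁M∣≡m ⟩
    where
    open ≡-Reasoning
    ∣∁M∣≡m : ∣ ∁ (set M) ∣ ≡ m
    ∣∁M∣≡m = begin
      ∣ ∁ (set M) ∣        ≡⟨ ∣∁p∣≡n∸∣p∣ (set M) ⟩
      m + (m + 0) ∸ ∣ set M ∣ ≡⟨ cong (m + (m + 0) ∸_) (cardinality M) ⟩
      m + (m + 0) ∸ m      ≡⟨ m+n∸m≡n m (m + 0) ⟩
      m + 0                ≡⟨ +-identityʳ m ⟩
      m                    ∎

  ∁ᴹ-involutive : ∀ M → ∁ᴹ (∁ᴹ M) ≡ M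
  ∁ᴹ-involutive M = MSubset-≡ (∁-involutive (set M))

  common : MSubset m → MSubset m → ℕ
  common M N = ∣ set M ∩ set N ∣

  common-comm : ∀ M N → common M N ≡ common N M
  common-comm M N = cong ∣_∣ (∩-comm (set M) (set N))

  common-∁ʳ : ∀ M N → common M (∁ᴹ N) ≡ m ∸ common M N
  common-∁ʳ M N = begin
    common M (∁ᴹ N)                               ≡⟨ m+n∸m≡n (common M N) _ ⟨
    common M N + common M (∁ᴹ N) ∸ common M N   ≡⟨ cong (_∸ common M N) ∣M∣≡m ⟩
    m ∸ common M N                                ∎
    where
    open ≡-Reasoning
    ∣M∣≡m = trans (∣p∩q∣+∣p∩∁q∣≡∣p∣ (set M) (set N)) (cardinality M)

  common-∁ˡ : ∀ M N → common (∁ᴹ M) N ≡ m ∸ common M N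
  common-∁ˡ M N = trans (common-comm (∁ᴹ M) N)
                     (trans (common-∁ʳ N M) (cong (m ∸_) (common-comm N M)))

  adj-∁ʳ : ∀ M N → Adj (J m) M N → Adj (J m) M (∁ᴹ N)
  adj-∁ʳ M N a = subst (Admissible m) (sym (common-∁ʳ M N)) (admissible-∸ a)

  adj-∁ˡ : ∀ M N → Adj (J m) M N → Adj (J m) (∁ᴹ M) N
  adj-∁ˡ M N a = subst (Admissible m) (sym (common-∁ˡ M N)) (admissible-∸ a)

  open Involution ∁ᴹ ∁ᴹ-involutive using (Orbit)

  orbit-adj : ∀ {M M′ N N′} → Orbit M M′ → Orbit N N′ → Adj (J m) M N → Adj (J m) M′ N′
  orbit-adj             (inj₁ refl) (inj₁ refl) a = a
  orbit-adj {M} {N = N} (inj₁ refl) (inj₂ refl) a = adj-∁ʳ M N a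
  orbit-adj {M} {N = N} (inj₂ refl) (inj₁ refl) a = adj-∁ˡ M N a
  orbit-adj {M} {N = N} (inj₂ refl) (inj₂ refl) a = adj-∁ˡ M (∁ᴹ N) (adj-∁ʳ M N a)

  orbitwise-automorphism : (h : MSubset m → MSubset m) →
                           (∀ M N → Adj (J m) M N → Adj (J m) (h M) (h N)) →
                           (g : MSubset m → MSubset m) → (∀ N → Orbit (h N) (g N)) →
                           (∀ N → g (g N) ≡ N) → Automorphism (J m)
  orbitwise-automorphism h h-adj g g-orbit g-involutive =
    involution⇒automorphism (J m) g g-involutive
      (λ M N a → orbit-adj (g-orbit M) (g-orbit N) (h-adj M N a))

∁ᴹ-colour-differs : ∀ {k r} (f : MSubset (suc k) → Fin r) →
                    Distinguishing (J (suc k)) r f → ∀ A → f (∁ᴹ A) ≢ f A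
∁ᴹ-colour-differs f D A f∁A≡fA =
  contradiction (∁p≡p⇒n≡0 (set A) (cong set ∁A≡A)) (λ ())
  where
  open Involution.OrbitTransposition ∁ᴹ ∁ᴹ-involutive _≟ᴹ_ A
  τ = orbitwise-automorphism id (λ _ _ a → a) transpose transpose-orbit transpose-involutive
  ∁A≡A : ∁ᴹ A ≡ A
  ∁A≡A = trans (sym transpose-A) (D τ (transpose-preserves f (sym f∁A≡fA)) A)

module _ {j : ℕ} where

  private
    m : ℕ
    m = suc (suc j)

  swapᴹ : MSubset m → MSubset m
  swapᴹ M = ⟨ swap₀₁ (set M) , trans (∣swap₀₁p∣≡∣p∣ (set M)) (cardinality M) ⟩

  swapᴹ-adj : ∀ M N → Adj (J m) M N → Adj (J m) (swapᴹ M) (swapᴹ N)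
  swapᴹ-adj M N = subst (Admissible m) (sym common-swap)
    where
    common-swap : common (swapᴹ M) (swapᴹ N) ≡ common M N
    common-swap = trans (cong ∣_∣ (swap₀₁-∩ (set M) (set N))) (∣swap₀₁p∣≡∣p∣ (set M ∩ set N))

  N₀ : MSubset m
  N₀ = ⟨ true ∷ false ∷ ⊥ {n = j} ++ false ∷ ⊤ ,
         cong suc (trans (∣⊥++p∣≡∣p∣ j (false ∷ ⊤)) (trans (∣⊤∣≡n (suc (j + 0)))
           (cong suc (+-identityʳ j)))) ⟩

  open Involution (∁ᴹ {m}) ∁ᴹ-involutive using (Orbit)

  N₀∉orbit-swapᴹN₀ : ¬ Orbit (swapᴹ N₀) N₀
  N₀∉orbit-swapᴹN₀ (inj₁ N₀≡swapN₀) with ∷-injectiveˡ (cong set N₀≡swapN₀)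
  ... | ()
  N₀∉orbit-swapᴹN₀ (inj₂ N₀≡∁swapN₀) =
    m+1+n≢0 j (∁p≡p⇒n≡0 _ (sym (∷-injectiveʳ (∷-injectiveʳ (cong set N₀≡∁swapN₀)))))

  no-2-distinguishing : (f : MSubset m → Fin 2) → ¬ Distinguishing (J m) 2 f
  no-2-distinguishing f D = N₀∉orbit-swapᴹN₀ (subst (Orbit (swapᴹ N₀)) φN₀≡N₀ (correct-orbit N₀))
    where
    open Involution.ColourCorrection ∁ᴹ ∁ᴹ-involutive swapᴹ (λ M → MSubset-≡ (swap₀₁-involutive (set M)))
           (λ M → MSubset-≡ (swap₀₁-∁ (set M))) f (∁ᴹ-colour-differs f D)
    φ = orbitwise-automorphism swapᴹ swapᴹ-adj correct correct-orbit correct-involutive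
    φN₀≡N₀ = D φ correct-preserves N₀

lemma3p8 : (m : ℕ) → 4 ≤ m → DistGreaterThan (J m) 2
lemma3p8 (suc 0) (s≤s ())
lemma3p8 (suc (suc j)) _ r r≤2 f D =
  no-2-distinguishing (λ N → inject≤ (f N) r≤2)
    (distinguishing-∘-injective (inject≤-injective r≤2 r≤2 _ _) D)
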